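{- For all positive integers $r$ and $j$, the exponential generating function of the numbers $p^r_j(n)$ is $$\sum_{n=0}^{\infty}\frac{p^r_j(n)\, m^n}{n!}=\frac{e^{rm}}{(2-e^m)^j}$$ (as formal power series in $m$).
   Context: For $n\ge 0$ let $X_n=\{1,\dots,n\}$. A preferential arrangement of a finite set $S$ is an ordered set partition of $S$ (a sequence of nonempty pairwise disjoint blocks with union $S$); the empty set has exactly one. Let $a(w)$ be the number of preferential arrangements of a $w$-element set ($a(0)=1$). A barred preferential arrangement of $X_n$ with $k$ bars is a sequence of $k+1$ possibly empty, pairwise disjoint sections $(S_1,\dots,S_{k+1})$ with union $X_n$, each equipped with a preferential arrangement of its elements. A restricted section is one whose preferential arrangement has at most one block (exactly one choice); a free section may carry any preferential arrangement. For integers $r,j\ge 0$, $p^r_j(n)$ denotes the number of barred preferential arrangements of $X_n$ with $r+j-1$ bars (i.e. $r+j$ sections) in which $r$ fixed sections are restricted and the remaining $j$ fixed sections are free; equivalently $$p^r_j(n)=\sum_{w_1+\cdots+w_{r+j}=n}\frac{n!}{w_1!\cdots w_{r+j}!}\prod_{i=r+1}^{r+j}a(w_i),$$ summing over nonnegative integer solutions. -}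

module Defs where

open import Data.Nat as ℕ using (ℕ; zero; suc; _∸_; _!; _≤?_)
import Data.Nat.Properties as ℕP
open import Data.Integer using (+_)
open import Data.Rational as ℚ using (ℚ; 0ℚ; 1ℚ)
import Data.Rational.Properties as ℚP
open import Data.List using (List; []; _∷_; upTo; concatMap; map)
open import Data.Nat.ListAction using (sum)
open import Data.Vec using (Vec; []; _∷_; drop; foldr)
open import Relation.Nullary using (yes; no)

S₂ : ℕ → ℕ → ℕ
S₂ zero    zero    = 1
S₂ zero    (suc k) = 0
S₂ (suc n) zero    = 0
S₂ (suc n) (suc k) = suc k ℕ.* S₂ n (suc k) ℕ.+ S₂ n k

-- a(w): number of preferential arrangements (ordered set partitions)
-- of a w-element set: choose a set partition into k blocks and one of
-- the k! orders of the blocks.  a 0 = 1.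
a : ℕ → ℕ
a w = sum (map (λ k → k ! ℕ.* S₂ w k) (upTo (suc w)))

compositions : (k n : ℕ) → List (Vec ℕ k)
compositions zero    zero    = [] ∷ []
compositions zero    (suc n) = []
compositions (suc k) n =
  concatMap (λ w → map (w ∷_) (compositions k (n ∸ w))) (upTo (suc n))

factProd : ∀ {k} → Vec ℕ k → ℕ
factProd = foldr _ (λ w p → w ! ℕ.* p) 1

factProd≢0 : ∀ {k} (v : Vec ℕ k) → ℕ.NonZero (factProd v)
factProd≢0 []       = _
factProd≢0 (w ∷ ws) =
  ℕP.m*n≢0 (w !) (factProd ws) {{ℕP._!≢0 w}} {{factProd≢0 ws}}

multinomial : ℕ → ∀ {k} → Vec ℕ k → ℕ
multinomial n v = ℕ._/_ (n !) (factProd v) {{factProd≢0 v}}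

vprod : ∀ {k} → Vec ℕ k → ℕ
vprod = foldr _ ℕ._*_ 1

p : (r j n : ℕ) → ℕ
p r j n = sum (map (λ v → multinomial n v ℕ.* vprod (Data.Vec.map a (drop r v)))
                   (compositions (r ℕ.+ j) n))

PowerSeries : Set
PowerSeries = ℕ → ℚ

sumTo : (ℕ → ℚ) → ℕ → ℚ
sumTo f zero    = f 0
sumTo f (suc n) = sumTo f n ℚ.+ f (suc n)

const : ℚ → PowerSeries
const c zero    = c
const c (suc n) = 0ℚ

_⊕_ : PowerSeries → PowerSeries → PowerSeries
(f ⊕ g) n = f n ℚ.+ g n

⊖_ : PowerSeries → PowerSeries
(⊖ f) n = ℚ.- f n

_⊛_ : PowerSeries → PowerSeries → PowerSeries
(f ⊛ g) n = sumTo (λ k → f k ℚ.* g (n ∸ k)) n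

_^ˢ_ : PowerSeries → ℕ → PowerSeries
f ^ˢ zero  = const 1ℚ
f ^ˢ suc j = f ⊛ (f ^ˢ j)

expS : ℕ → PowerSeries
expS c n = ℚ._/_ (+ (c ℕ.^ n)) (n !) {{ℕP._!≢0 n}}

-- multiplicative inverse of a power series g with g 0 ≠ 0:
-- b₀ = 1/g₀,  b_n = -(1/g₀) Σ_{i=1}^{n} g_i b_{n-i}.
-- invApprox c g n k is b_k for k ≤ n (c = 1/g₀).
private
  invApprox : ℚ → PowerSeries → ℕ → ℕ → ℚ
  invApprox c g zero    k = c
  invApprox c g (suc n) k with k ≤? n
  ... | yes _ = invApprox c g n k
  ... | no  _ = ℚ.- c ℚ.* sumTo (λ i → g (suc i) ℚ.* invApprox c g n (n ∸ i)) n

-- (junk value 0 if g 0 = 0, where no inverse exists)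
inv : PowerSeries → PowerSeries
inv g n with g 0 ℚP.≟ 0ℚ
... | yes _  = 0ℚ
... | no g₀≢0 = invApprox (ℚ.1/_ (g 0) {{ℚ.≢-nonZero g₀≢0}}) g n n

_⊘_ : PowerSeries → PowerSeries → PowerSeries
f ⊘ g = f ⊛ inv g

egf : (ℕ → ℕ) → PowerSeries
egf s n = ℚ._/_ (+ s n) (n !) {{ℕP._!≢0 n}}

-- Splitting X_n over the r + j sections, the multinomial coefficient turns the sum over
-- compositions into a Cauchy product of exponential generating functions:
-- Σ p^r_j(n) m^n/n! = (e^m)^r · A^j with A = Σ a(w) m^w/w!.  As a(w) = Σ_k k! S₂(w,k),
-- A = Σ_k U_k where U_k (ordPartitions k) is the egf of k! S₂(·,k).  The Stirling recurrence says
-- U_{k+1}' = (k+1)(U_{k+1} + U_k); this first-order equation is also solved by U_k (e^m − 1),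
-- with the same constant term, so U_{k+1} = U_k (e^m − 1).  Hence A (2 − e^m) = Σ_k (U_k − U_{k+1})
-- telescopes to U_0 = 1 (coefficientwise the sum is finite, as U_k starts at m^k).  In the same
-- way e^{(c+1)m} = e^m e^{cm}, both sides solving f' = (c+1) f.  Finally (2 − e^m)^j has constant
-- term 1 and quotients by such series are unique.

module Submission where

open import Defs
open import Data.Nat as ℕ using (ℕ; zero; suc; _∸_; _!; _<_; z≤n; s≤s)
import Data.Nat.Properties as ℕP
open import Data.Integer as ℤ using (+_)
import Data.Integer.Properties as ℤP
open import Data.Rational as ℚ using (ℚ; 0ℚ; 1ℚ; _/_; _+_; _*_; -_; toℚᵘ)
import Data.Rational.Properties as ℚP
open import Data.Rational.Unnormalised as ℚᵘ using (mkℚᵘ; *≡*)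
import Data.Rational.Unnormalised.Properties as ℚᵘP
open import Data.Integer.Tactic.RingSolver using () renaming (solve-∀ to ℤ-solve-∀)
open import Data.Nat.Tactic.RingSolver using () renaming (solve-∀ to ℕ-solve-∀)
open import Relation.Binary.PropositionalEquality
open import Relation.Nullary using (yes; no)
open import Data.Empty using (⊥-elim)
open import Algebra.Bundles using (CommutativeMonoid)
open import Algebra.Properties.CommutativeSemigroup
  (CommutativeMonoid.commutativeSemigroup ℚP.*-1-commutativeMonoid)
  using () renaming (interchange to *-interchange; xy∙z≈y∙xz to *-xy∙z≈y∙xz; x∙yz≈y∙xz to *-x∙yz≈y∙xz)
open import Algebra.Properties.CommutativeSemigroup
  (CommutativeMonoid.commutativeSemigroup ℚP.+-0-commutativeMonoid)
  using () renaming (interchange to +-interchange)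
open import Data.Rational.Solver using (module +-*-Solver)
import Relation.Binary.Reasoning.Setoid as SetoidReasoning
open import Data.List as List using (List; []; _∷_; _++_; concatMap; applyUpTo)
open import Data.Nat.ListAction using (sum)
open import Data.List.Relation.Unary.All as All using (All; []; _∷_)
import Data.List.Relation.Unary.All.Properties as AllP
open import Data.Vec as Vec using (Vec; []; _∷_; drop) renaming (_++_ to _++ᵛ_)
open import Data.Nat.Divisibility using (_∣_; ∣-refl; ∣-trans; *-monoʳ-∣)
open import Data.Nat.Combinatorics using (k![n∸k]!∣n!)
import Data.Nat.DivMod as ℕDM

fromℕ : ℕ → ℚ
fromℕ n = + n / 1

toℚᵘ-/ : ∀ i d → toℚᵘ (i / suc d) ℚᵘ.≃ mkℚᵘ i d
toℚᵘ-/ i d = ℚP.toℚᵘ-fromℚᵘ (mkℚᵘ i d)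

fromℕ-+ : ∀ m n → fromℕ (m ℕ.+ n) ≡ fromℕ m + fromℕ n
fromℕ-+ m n = ℚP.toℚᵘ-injective (begin
  toℚᵘ (fromℕ (m ℕ.+ n))              ≈⟨ toℚᵘ-/ _ 0 ⟩
  mkℚᵘ (+ (m ℕ.+ n)) 0                ≈⟨ *≡* (trans (cong (ℤ._* + 1) (ℤP.pos-+ m n)) (ring (+ m) (+ n))) ⟩
  mkℚᵘ (+ m) 0 ℚᵘ.+ mkℚᵘ (+ n) 0      ≈⟨ ℚᵘP.+-cong (≃-sym (toℚᵘ-/ (+ m) 0)) (≃-sym (toℚᵘ-/ (+ n) 0)) ⟩
  toℚᵘ (fromℕ m) ℚᵘ.+ toℚᵘ (fromℕ n)  ≈⟨ ≃-sym (ℚP.toℚᵘ-homo-+ (fromℕ m) (fromℕ n)) ⟩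
  toℚᵘ (fromℕ m + fromℕ n)            ∎)
  where
  open ℚᵘP.≃-Reasoning
  open ℚᵘP using (≃-sym)
  ring : ∀ x y → (x ℤ.+ y) ℤ.* + 1 ≡ (x ℤ.* + 1 ℤ.+ y ℤ.* + 1) ℤ.* (+ 1 ℤ.* + 1)
  ring = ℤ-solve-∀

fromℕ-* : ∀ m n → fromℕ (m ℕ.* n) ≡ fromℕ m * fromℕ n
fromℕ-* m n = ℚP.toℚᵘ-injective (begin
  toℚᵘ (fromℕ (m ℕ.* n))              ≈⟨ toℚᵘ-/ _ 0 ⟩
  mkℚᵘ (+ (m ℕ.* n)) 0                ≈⟨ *≡* (trans (cong (ℤ._* + 1) (ℤP.pos-* m n)) (ring (+ m) (+ n))) ⟩
  mkℚᵘ (+ m) 0 ℚᵘ.* mkℚᵘ (+ n) 0      ≈⟨ ℚᵘP.*-cong (≃-sym (toℚᵘ-/ (+ m) 0)) (≃-sym (toℚᵘ-/ (+ n) 0)) ⟩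
  toℚᵘ (fromℕ m) ℚᵘ.* toℚᵘ (fromℕ n)  ≈⟨ ≃-sym (ℚP.toℚᵘ-homo-* (fromℕ m) (fromℕ n)) ⟩
  toℚᵘ (fromℕ m * fromℕ n)            ∎)
  where
  open ℚᵘP.≃-Reasoning
  open ℚᵘP using (≃-sym)
  ring : ∀ x y → (x ℤ.* y) ℤ.* + 1 ≡ (x ℤ.* y) ℤ.* (+ 1 ℤ.* + 1)
  ring = ℤ-solve-∀

/-*-fromℕ : ∀ x d .{{_ : ℕ.NonZero d}} → (+ x / d) * fromℕ d ≡ fromℕ x
/-*-fromℕ x d@(suc d-1) = ℚP.toℚᵘ-injective (begin
  toℚᵘ ((+ x / d) * fromℕ d)             ≈⟨ ℚP.toℚᵘ-homo-* (+ x / d) (fromℕ d) ⟩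
  toℚᵘ (+ x / d) ℚᵘ.* toℚᵘ (fromℕ d)     ≈⟨ ℚᵘP.*-cong (toℚᵘ-/ (+ x) d-1) (toℚᵘ-/ (+ d) 0) ⟩
  mkℚᵘ (+ x) d-1 ℚᵘ.* mkℚᵘ (+ d) 0       ≈⟨ *≡* (ring (+ x) (+ d)) ⟩
  mkℚᵘ (+ x) 0                           ≈⟨ ℚᵘP.≃-sym (toℚᵘ-/ (+ x) 0) ⟩
  toℚᵘ (fromℕ x)                         ∎)
  where
  open ℚᵘP.≃-Reasoning
  ring : ∀ x y → (x ℤ.* y) ℤ.* + 1 ≡ x ℤ.* (y ℤ.* + 1)
  ring = ℤ-solve-∀

fromℕ-nonZero : ∀ d .{{_ : ℕ.NonZero d}} → ℚ.NonZero (fromℕ d)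
fromℕ-nonZero d@(suc _) = ℚP.pos⇒nonZero (fromℕ d) {{ℚP.normalize-pos d 1}}

*-cancelʳ-fromℕ : ∀ d .{{_ : ℕ.NonZero d}} {p q : ℚ} → p * fromℕ d ≡ q * fromℕ d → p ≡ q
*-cancelʳ-fromℕ d {p} {q} eq = begin
  p                          ≡⟨ cancel p ⟨
  p * fromℕ d * ℚ.1/ fromℕ d  ≡⟨ cong (_* ℚ.1/ fromℕ d) eq ⟩
  q * fromℕ d * ℚ.1/ fromℕ d  ≡⟨ cancel q ⟩
  q                          ∎
  where
  open ≡-Reasoning
  instance
    fromℕ-d-nonZero : ℚ.NonZero (fromℕ d)
    fromℕ-d-nonZero = fromℕ-nonZero d
  cancel : ∀ r → r * fromℕ d * ℚ.1/ fromℕ d ≡ r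
  cancel r = trans (ℚP.*-assoc r _ _) (trans (cong (r *_) (ℚP.*-inverseʳ (fromℕ d))) (ℚP.*-identityʳ r))

/-unique : ∀ {q} x d .{{_ : ℕ.NonZero d}} → q * fromℕ d ≡ fromℕ x → q ≡ + x / d
/-unique x d eq = *-cancelʳ-fromℕ d (trans eq (sym (/-*-fromℕ x d)))

/-+ : ∀ x y d .{{_ : ℕ.NonZero d}} → + x / d + + y / d ≡ + (x ℕ.+ y) / d
/-+ x y d = /-unique (x ℕ.+ y) d (begin
  (+ x / d + + y / d) * fromℕ d                ≡⟨ ℚP.*-distribʳ-+ (fromℕ d) (+ x / d) (+ y / d) ⟩
  (+ x / d) * fromℕ d + (+ y / d) * fromℕ d    ≡⟨ cong₂ _+_ (/-*-fromℕ x d) (/-*-fromℕ y d) ⟩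
  fromℕ x + fromℕ y                            ≡⟨ fromℕ-+ x y ⟨
  fromℕ (x ℕ.+ y)                              ∎)
  where open ≡-Reasoning

/-* : ∀ x y m n .{{_ : ℕ.NonZero m}} .{{_ : ℕ.NonZero n}} →
      (+ x / m) * (+ y / n) ≡ ℚ._/_ (+ (x ℕ.* y)) (m ℕ.* n) {{ℕP.m*n≢0 m n}}
/-* x y m n = /-unique (x ℕ.* y) (m ℕ.* n) {{ℕP.m*n≢0 m n}} (begin
  (+ x / m) * (+ y / n) * fromℕ (m ℕ.* n)              ≡⟨ cong ((+ x / m) * (+ y / n) *_) (fromℕ-* m n) ⟩
  (+ x / m) * (+ y / n) * (fromℕ m * fromℕ n)          ≡⟨ *-interchange (+ x / m) (+ y / n) (fromℕ m) (fromℕ n) ⟩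
  (+ x / m) * fromℕ m * ((+ y / n) * fromℕ n)          ≡⟨ cong₂ _*_ (/-*-fromℕ x m) (/-*-fromℕ y n) ⟩
  fromℕ x * fromℕ y                                    ≡⟨ fromℕ-* x y ⟨
  fromℕ (x ℕ.* y)                                      ∎)
  where open ≡-Reasoning

fromℕ-*-/ : ∀ m x d .{{_ : ℕ.NonZero d}} → fromℕ m * (+ x / d) ≡ + (m ℕ.* x) / d
fromℕ-*-/ m x d = /-unique (m ℕ.* x) d (begin
  fromℕ m * (+ x / d) * fromℕ d    ≡⟨ ℚP.*-assoc (fromℕ m) (+ x / d) (fromℕ d) ⟩
  fromℕ m * ((+ x / d) * fromℕ d)  ≡⟨ cong (fromℕ m *_) (/-*-fromℕ x d) ⟩
  fromℕ m * fromℕ x                ≡⟨ fromℕ-* m x ⟨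
  fromℕ (m ℕ.* x)                  ∎)
  where open ≡-Reasoning

fromℕ-*-/-cancelˡ : ∀ m x d .{{_ : ℕ.NonZero m}} .{{_ : ℕ.NonZero d}} →
              fromℕ m * ℚ._/_ (+ x) (m ℕ.* d) {{ℕP.m*n≢0 m d}} ≡ + x / d
fromℕ-*-/-cancelˡ m x d = /-unique x d (begin
  fromℕ m * x/md * fromℕ d      ≡⟨ *-xy∙z≈y∙xz (fromℕ m) x/md (fromℕ d) ⟩
  x/md * (fromℕ m * fromℕ d)    ≡⟨ cong (x/md *_) (fromℕ-* m d) ⟨
  x/md * fromℕ (m ℕ.* d)        ≡⟨ /-*-fromℕ x (m ℕ.* d) {{ℕP.m*n≢0 m d}} ⟩
  fromℕ x                       ∎)
  where
  open ≡-Reasoning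
  x/md : ℚ
  x/md = ℚ._/_ (+ x) (m ℕ.* d) {{ℕP.m*n≢0 m d}}

module _ where
  open ≡-Reasoning

  sumTo-cong : ∀ {f g : ℕ → ℚ} n → (∀ i → i ℕ.≤ n → f i ≡ g i) → sumTo f n ≡ sumTo g n
  sumTo-cong zero    eq = eq 0 z≤n
  sumTo-cong (suc n) eq = cong₂ _+_ (sumTo-cong n (λ i i≤n → eq i (ℕP.m≤n⇒m≤1+n i≤n))) (eq (suc n) ℕP.≤-refl)

  sumTo-+ : ∀ (f g : ℕ → ℚ) n → sumTo (λ i → f i + g i) n ≡ sumTo f n + sumTo g n
  sumTo-+ f g zero    = refl
  sumTo-+ f g (suc n) = trans (cong (_+ (f (suc n) + g (suc n))) (sumTo-+ f g n))
                              (+-interchange (sumTo f n) (sumTo g n) (f (suc n)) (g (suc n)))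

  sumTo-*ˡ : ∀ a (f : ℕ → ℚ) n → sumTo (λ i → a * f i) n ≡ a * sumTo f n
  sumTo-*ˡ a f zero    = refl
  sumTo-*ˡ a f (suc n) = trans (cong (_+ a * f (suc n)) (sumTo-*ˡ a f n))
                               (sym (ℚP.*-distribˡ-+ a (sumTo f n) (f (suc n))))

  sumTo-*ʳ : ∀ a (f : ℕ → ℚ) n → sumTo (λ i → f i * a) n ≡ sumTo f n * a
  sumTo-*ʳ a f n = begin
    sumTo (λ i → f i * a) n  ≡⟨ sumTo-cong n (λ i _ → ℚP.*-comm (f i) a) ⟩
    sumTo (λ i → a * f i) n  ≡⟨ sumTo-*ˡ a f n ⟩
    a * sumTo f n            ≡⟨ ℚP.*-comm a (sumTo f n) ⟩
    sumTo f n * a            ∎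

  sumTo-neg : ∀ (f : ℕ → ℚ) n → sumTo (λ i → - f i) n ≡ - sumTo f n
  sumTo-neg f zero    = refl
  sumTo-neg f (suc n) = trans (cong (_+ - f (suc n)) (sumTo-neg f n))
                              (sym (ℚP.neg-distrib-+ (sumTo f n) (f (suc n))))

  sumTo-zero : ∀ n → sumTo (λ _ → 0ℚ) n ≡ 0ℚ
  sumTo-zero zero    = refl
  sumTo-zero (suc n) = cong (_+ 0ℚ) (sumTo-zero n)

  sumTo-sucˡ : ∀ (f : ℕ → ℚ) n → sumTo f (suc n) ≡ f 0 + sumTo (λ i → f (suc i)) n
  sumTo-sucˡ f zero    = refl
  sumTo-sucˡ f (suc n) = trans (cong (_+ f (suc (suc n))) (sumTo-sucˡ f n))
                               (ℚP.+-assoc (f 0) (sumTo (λ i → f (suc i)) n) (f (suc (suc n))))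

  sumTo-reverse : ∀ (f : ℕ → ℚ) n → sumTo f n ≡ sumTo (λ i → f (n ∸ i)) n
  sumTo-reverse f zero    = refl
  sumTo-reverse f (suc n) = begin
    sumTo f n + f (suc n)                  ≡⟨ cong (_+ f (suc n)) (sumTo-reverse f n) ⟩
    sumTo (λ i → f (n ∸ i)) n + f (suc n)  ≡⟨ ℚP.+-comm _ (f (suc n)) ⟩
    f (suc n) + sumTo (λ i → f (n ∸ i)) n  ≡⟨ sumTo-sucˡ (λ i → f (suc n ∸ i)) n ⟨
    sumTo (λ i → f (suc n ∸ i)) (suc n)    ∎

  sumTo-swap : ∀ (H : ℕ → ℕ → ℚ) n m →
               sumTo (λ i → sumTo (H i) m) n ≡ sumTo (λ k → sumTo (λ i → H i k) n) m
  sumTo-swap H zero    m = refl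
  sumTo-swap H (suc n) m = trans (cong (_+ sumTo (H (suc n)) m) (sumTo-swap H n m))
                                 (sym (sumTo-+ (λ k → sumTo (λ i → H i k) n) (H (suc n)) m))

  sumTo-triangle : ∀ (H : ℕ → ℕ → ℚ) n →
    sumTo (λ k → sumTo (λ i → H i k) k) n ≡ sumTo (λ i → sumTo (λ l → H i (i ℕ.+ l)) (n ∸ i)) n
  sumTo-triangle H zero    = refl
  sumTo-triangle H (suc n) = begin
    sumTo (λ k → sumTo (λ i → H i k) k) n + (column + H (suc n) (suc n))
      ≡⟨ cong (_+ (column + H (suc n) (suc n))) (sumTo-triangle H n) ⟩
    rows n + (column + H (suc n) (suc n))
      ≡⟨ ℚP.+-assoc (rows n) column _ ⟨
    rows n + column + H (suc n) (suc n)
      ≡⟨ cong₂ _+_ (sym (sumTo-+ (λ i → row i (n ∸ i)) (λ i → H i (suc n)) n)) lastRow ⟩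
    sumTo (λ i → row i (n ∸ i) + H i (suc n)) n + row (suc n) (n ∸ n)
      ≡⟨ cong (_+ row (suc n) (n ∸ n)) (sumTo-cong n extendRow) ⟩
    sumTo (λ i → row i (suc n ∸ i)) n + row (suc n) (n ∸ n)
      ∎
    where
    row : ℕ → ℕ → ℚ
    row i = sumTo (λ l → H i (i ℕ.+ l))
    rows : ℕ → ℚ
    rows m = sumTo (λ i → row i (m ∸ i)) m
    column : ℚ
    column = sumTo (λ i → H i (suc n)) n
    lastRow : H (suc n) (suc n) ≡ row (suc n) (n ∸ n)
    lastRow rewrite ℕP.n∸n≡0 n | ℕP.+-identityʳ n = refl
    extendRow : ∀ i → i ℕ.≤ n → row i (n ∸ i) + H i (suc n) ≡ row i (suc n ∸ i)
    extendRow i i≤n rewrite ℕP.+-∸-assoc 1 i≤n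
      = cong (λ k → row i (n ∸ i) + H i k) (sym (trans (ℕP.+-suc i (n ∸ i)) (cong suc (ℕP.m+[n∸m]≡n i≤n))))

  sumTo-extend : ∀ (f : ℕ → ℚ) {n N} → (∀ k → n < k → f k ≡ 0ℚ) → n ℕ.≤ N → sumTo f N ≡ sumTo f n
  sumTo-extend f {n} vanish n≤N with ℕP.≤⇒≤′ n≤N
  ... | ℕ.≤′-refl       = refl
  ... | ℕ.≤′-step n≤′N = trans (cong₂ _+_ (sumTo-extend f vanish (ℕP.≤′⇒≤ n≤′N))
                                          (vanish _ (s≤s (ℕP.≤′⇒≤ n≤′N))))
                               (ℚP.+-identityʳ (sumTo f n))

  sumTo-telescope : ∀ (f : ℕ → ℚ) n → sumTo (λ k → f k ℚ.- f (suc k)) n ≡ f 0 ℚ.- f (suc n)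
  sumTo-telescope f zero    = refl
  sumTo-telescope f (suc n) = trans (cong (_+ (f (suc n) ℚ.- f (suc (suc n)))) (sumTo-telescope f n))
                                    (cancel (f 0) (f (suc n)) (f (suc (suc n))))
    where
    open +-*-Solver
    cancel : ∀ x y z → x ℚ.- y + (y ℚ.- z) ≡ x ℚ.- z
    cancel = solve 3 (λ x y z → (x :- y) :+ (y :- z) := x :- z) refl

module SeriesReasoning = SetoidReasoning (ℕ →-setoid ℚ)

_·_ : ℚ → PowerSeries → PowerSeries
(a · f) n = a * f n

module _ where
  open ≡-Reasoning

  ⊛-cong : ∀ {f f′ g g′} → f ≗ f′ → g ≗ g′ → f ⊛ g ≗ f′ ⊛ g′
  ⊛-cong f≗f′ g≗g′ n = sumTo-cong n (λ k _ → cong₂ _*_ (f≗f′ k) (g≗g′ (n ∸ k)))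

  ⊛-congˡ : ∀ f {g g′} → g ≗ g′ → f ⊛ g ≗ f ⊛ g′
  ⊛-congˡ f {g} {g′} = ⊛-cong {f} {f} {g} {g′} (λ _ → refl)

  ⊛-congʳ : ∀ g {f f′} → f ≗ f′ → f ⊛ g ≗ f′ ⊛ g
  ⊛-congʳ g {f} {f′} f≗f′ = ⊛-cong {f} {f′} {g} {g} f≗f′ (λ _ → refl)

  ⊛-comm : ∀ f g → f ⊛ g ≗ g ⊛ f
  ⊛-comm f g n = trans (sumTo-reverse (λ k → f k * g (n ∸ k)) n) (sumTo-cong n swap)
    where
    swap : ∀ i → i ℕ.≤ n → f (n ∸ i) * g (n ∸ (n ∸ i)) ≡ g i * f (n ∸ i)
    swap i i≤n rewrite ℕP.m∸[m∸n]≡n i≤n = ℚP.*-comm (f (n ∸ i)) (g i)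

  ⊛-assoc : ∀ f g h → (f ⊛ g) ⊛ h ≗ f ⊛ (g ⊛ h)
  ⊛-assoc f g h n = begin
    sumTo (λ k → sumTo (λ i → f i * g (k ∸ i)) k * h (n ∸ k)) n
      ≡⟨ sumTo-cong n (λ k _ → sym (sumTo-*ʳ (h (n ∸ k)) (λ i → f i * g (k ∸ i)) k)) ⟩
    sumTo (λ k → sumTo (λ i → f i * g (k ∸ i) * h (n ∸ k)) k) n
      ≡⟨ sumTo-triangle (λ i k → f i * g (k ∸ i) * h (n ∸ k)) n ⟩
    sumTo (λ i → sumTo (λ l → f i * g (i ℕ.+ l ∸ i) * h (n ∸ (i ℕ.+ l))) (n ∸ i)) n
      ≡⟨ sumTo-cong n (λ i _ → trans (sumTo-cong (n ∸ i) (λ l _ → reindex i l))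
                                     (sumTo-*ˡ (f i) (λ l → g l * h (n ∸ i ∸ l)) (n ∸ i))) ⟩
    sumTo (λ i → f i * sumTo (λ l → g l * h (n ∸ i ∸ l)) (n ∸ i)) n
      ∎
    where
    reindex : ∀ i l → f i * g (i ℕ.+ l ∸ i) * h (n ∸ (i ℕ.+ l)) ≡ f i * (g l * h (n ∸ i ∸ l))
    reindex i l rewrite ℕP.m+n∸m≡n i l | sym (ℕP.∸-+-assoc n i l) = ℚP.*-assoc (f i) (g l) (h (n ∸ i ∸ l))

  ⊛-distribˡ-⊕ : ∀ h f g → h ⊛ (f ⊕ g) ≗ (h ⊛ f) ⊕ (h ⊛ g)
  ⊛-distribˡ-⊕ h f g n =
    trans (sumTo-cong n (λ k _ → ℚP.*-distribˡ-+ (h k) (f (n ∸ k)) (g (n ∸ k))))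
          (sumTo-+ (λ k → h k * f (n ∸ k)) (λ k → h k * g (n ∸ k)) n)

  ⊛-distribʳ-⊕ : ∀ h f g → (f ⊕ g) ⊛ h ≗ (f ⊛ h) ⊕ (g ⊛ h)
  ⊛-distribʳ-⊕ h f g n =
    trans (sumTo-cong n (λ k _ → ℚP.*-distribʳ-+ (h (n ∸ k)) (f k) (g k)))
          (sumTo-+ (λ k → f k * h (n ∸ k)) (λ k → g k * h (n ∸ k)) n)

  ·-⊛ : ∀ a f g → (a · f) ⊛ g ≗ a · (f ⊛ g)
  ·-⊛ a f g n = trans (sumTo-cong n (λ k _ → ℚP.*-assoc a (f k) (g (n ∸ k))))
                      (sumTo-*ˡ a (λ k → f k * g (n ∸ k)) n)

  ⊛-· : ∀ a f g → f ⊛ (a · g) ≗ a · (f ⊛ g)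
  ⊛-· a f g n = trans (⊛-comm f (a · g) n) (trans (·-⊛ a g f n) (cong (a *_) (⊛-comm g f n)))

  ⊖-⊛ : ∀ f g → (⊖ f) ⊛ g ≗ ⊖ (f ⊛ g)
  ⊖-⊛ f g n = trans (sumTo-cong n (λ k _ → sym (ℚP.neg-distribˡ-* (f k) (g (n ∸ k)))))
                    (sumTo-neg (λ k → f k * g (n ∸ k)) n)

  ⊛-⊖ : ∀ f g → f ⊛ (⊖ g) ≗ ⊖ (f ⊛ g)
  ⊛-⊖ f g n = trans (⊛-comm f (⊖ g) n) (trans (⊖-⊛ g f n) (cong -_ (⊛-comm g f n)))

  const-⊛ : ∀ a f → const a ⊛ f ≗ a · f
  const-⊛ a f zero    = refl
  const-⊛ a f (suc n) = begin
    sumTo (λ k → const a k * f (suc n ∸ k)) (suc n)  ≡⟨ sumTo-sucˡ (λ k → const a k * f (suc n ∸ k)) n ⟩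
    a * f (suc n) + sumTo (λ k → 0ℚ * f (n ∸ k)) n   ≡⟨ cong (_+_ (a * f (suc n))) vanish ⟩
    a * f (suc n) + 0ℚ                               ≡⟨ ℚP.+-identityʳ (a * f (suc n)) ⟩
    a * f (suc n)                                    ∎
    where
    vanish : sumTo (λ k → 0ℚ * f (n ∸ k)) n ≡ 0ℚ
    vanish = trans (sumTo-cong n (λ k _ → ℚP.*-zeroˡ (f (n ∸ k)))) (sumTo-zero n)

  ⊛-identityˡ : ∀ f → const 1ℚ ⊛ f ≗ f
  ⊛-identityˡ f n = trans (const-⊛ 1ℚ f n) (ℚP.*-identityˡ (f n))

  ⊛-identityʳ : ∀ f → f ⊛ const 1ℚ ≗ f
  ⊛-identityʳ f n = trans (⊛-comm f (const 1ℚ) n) (⊛-identityˡ f n)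

^ˢ-cong : ∀ {f g} j → f ≗ g → f ^ˢ j ≗ g ^ˢ j
^ˢ-cong zero    f≗g = λ _ → refl
^ˢ-cong (suc j) f≗g = ⊛-cong f≗g (^ˢ-cong j f≗g)

1^ˢ : ∀ j → const 1ℚ ^ˢ j ≗ const 1ℚ
1^ˢ zero    = λ _ → refl
1^ˢ (suc j) n = trans (⊛-congˡ (const 1ℚ) (1^ˢ j) n) (⊛-identityˡ (const 1ℚ) n)

^ˢ-constantTerm : ∀ f j → f 0 ≡ 1ℚ → (f ^ˢ j) 0 ≡ 1ℚ
^ˢ-constantTerm f zero    f₀≡1 = refl
^ˢ-constantTerm f (suc j) f₀≡1 = cong₂ _*_ f₀≡1 (^ˢ-constantTerm f j f₀≡1)

⊛-^ˢ : ∀ f g j → (f ⊛ g) ^ˢ j ≗ (f ^ˢ j) ⊛ (g ^ˢ j)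
⊛-^ˢ f g zero    n = sym (⊛-identityˡ (const 1ℚ) n)
⊛-^ˢ f g (suc j) = begin
  (f ⊛ g) ⊛ ((f ⊛ g) ^ˢ j)   ≈⟨ ⊛-congˡ (f ⊛ g) (⊛-^ˢ f g j) ⟩
  (f ⊛ g) ⊛ (fʲ ⊛ gʲ)        ≈⟨ ⊛-assoc f g (fʲ ⊛ gʲ) ⟩
  f ⊛ (g ⊛ (fʲ ⊛ gʲ))        ≈⟨ ⊛-congˡ f (⊛-assoc g fʲ gʲ) ⟨
  f ⊛ ((g ⊛ fʲ) ⊛ gʲ)        ≈⟨ ⊛-congˡ f (⊛-congʳ gʲ (⊛-comm g fʲ)) ⟩
  f ⊛ ((fʲ ⊛ g) ⊛ gʲ)        ≈⟨ ⊛-congˡ f (⊛-assoc fʲ g gʲ) ⟩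
  f ⊛ (fʲ ⊛ (g ⊛ gʲ))        ≈⟨ ⊛-assoc f fʲ (g ⊛ gʲ) ⟨
  (f ⊛ fʲ) ⊛ (g ⊛ gʲ)        ∎
  where
  open SeriesReasoning
  fʲ gʲ : PowerSeries
  fʲ = f ^ˢ j
  gʲ = g ^ˢ j

-- Defs computes `inv` with a private helper, which cannot be named here.  The meta `approx` is
-- solved by unification in `inv-suc-approx`, where the helper occurs applied to variables only:
-- approx c g n i is the helper's value at (n , n ∸ i).
mutual
  approx : ℚ → PowerSeries → ℕ → ℕ → ℚ
  approx = _

  inv-suc-approx : ∀ g (g₀≢0 : g 0 ≢ 0ℚ) n → let c = ℚ.1/_ (g 0) {{ℚ.≢-nonZero g₀≢0}} in
                   inv g (suc n) ≡ - c * sumTo (λ i → g (suc i) * approx c g n i) n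
  inv-suc-approx g g₀≢0 n with g 0 ℚP.≟ 0ℚ
  ... | yes g₀≡0 = ⊥-elim (g₀≢0 g₀≡0)
  ... | no _ with ℚ.1/_ (g 0) {{ℚ.≢-nonZero g₀≢0}} | suc n ℕ.≤? n
  ...   | c | yes 1+n≤n = ⊥-elim (ℕP.<-irrefl refl 1+n≤n)
  ...   | c | no _      = refl

approx-suc : ∀ c g n i → approx c g (suc n) (suc i) ≡ approx c g n i
approx-suc c g n i with n ∸ i ℕ.≤? n
... | yes _   = refl
... | no  n∸i≰n = ⊥-elim (n∸i≰n (ℕP.m∸n≤m n i))

approx-diagonal : ∀ c g n i → i ℕ.≤ n → approx c g n i ≡ approx c g (n ∸ i) 0
approx-diagonal c g n       zero    _         = refl
approx-diagonal c g (suc n) (suc i) (s≤s i≤n) = trans (approx-suc c g n i) (approx-diagonal c g n i i≤n)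

module _ (g : PowerSeries) (g₀≢0 : g 0 ≢ 0ℚ) where
  private
    instance
      g₀-nonZero : ℚ.NonZero (g 0)
      g₀-nonZero = ℚ.≢-nonZero g₀≢0

  inv≡approx : ∀ n → inv g n ≡ approx (ℚ.1/ g 0) g n 0
  inv≡approx n with g 0 ℚP.≟ 0ℚ
  ... | yes g₀≡0 = ⊥-elim (g₀≢0 g₀≡0)
  ... | no _     = refl

  inv-suc : ∀ n → inv g (suc n) ≡ - ℚ.1/ g 0 * sumTo (λ i → g (suc i) * inv g (n ∸ i)) n
  inv-suc n = trans (inv-suc-approx g g₀≢0 n)
    (cong (λ s → - ℚ.1/ g 0 * s) (sumTo-cong n (λ i i≤n → cong (g (suc i) *_)
      (trans (approx-diagonal (ℚ.1/ g 0) g n i i≤n) (sym (inv≡approx (n ∸ i)))))))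

  ⊛-inverseʳ : g ⊛ inv g ≗ const 1ℚ
  ⊛-inverseʳ zero    = trans (cong (g 0 *_) (inv≡approx 0)) (ℚP.*-inverseʳ (g 0))
  ⊛-inverseʳ (suc n) = begin
    (g ⊛ inv g) (suc n)            ≡⟨ sumTo-sucˡ (λ k → g k * inv g (suc n ∸ k)) n ⟩
    g 0 * inv g (suc n) + s        ≡⟨ cong (λ x → g 0 * x + s) (inv-suc n) ⟩
    g 0 * (- ℚ.1/ g 0 * s) + s     ≡⟨ cong (_+ s) (ℚP.*-assoc (g 0) _ s) ⟨
    g 0 * - ℚ.1/ g 0 * s + s       ≡⟨ cong (λ x → x * s + s) (ℚP.neg-distribʳ-* (g 0) _) ⟨
    - (g 0 * ℚ.1/ g 0) * s + s     ≡⟨ cong (λ x → - x * s + s) (ℚP.*-inverseʳ (g 0)) ⟩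
    - 1ℚ * s + s                   ≡⟨ cong (_+ s) (ℚP.neg-distribˡ-* 1ℚ s) ⟨
    - (1ℚ * s) + s                 ≡⟨ cong (λ x → - x + s) (ℚP.*-identityˡ s) ⟩
    - s + s                        ≡⟨ ℚP.+-inverseˡ s ⟩
    0ℚ                             ∎
    where
    open ≡-Reasoning
    s : ℚ
    s = sumTo (λ i → g (suc i) * inv g (n ∸ i)) n

  ⊘-unique : ∀ {f q} → q ⊛ g ≗ f → q ≗ f ⊘ g
  ⊘-unique {f} {q} q⊛g≗f = begin
    q                    ≈⟨ ⊛-identityʳ q ⟨
    q ⊛ const 1ℚ         ≈⟨ ⊛-congˡ q ⊛-inverseʳ ⟨
    q ⊛ (g ⊛ inv g)      ≈⟨ ⊛-assoc q g (inv g) ⟨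
    (q ⊛ g) ⊛ inv g      ≈⟨ ⊛-congʳ (inv g) q⊛g≗f ⟩
    f ⊛ inv g            ∎
    where open SeriesReasoning

D : PowerSeries → PowerSeries
D f n = fromℕ (suc n) * f (suc n)

module _ where
  open ≡-Reasoning

  D-egf : ∀ s → D (egf s) ≗ egf (λ n → s (suc n))
  D-egf s n = fromℕ-*-/-cancelˡ (suc n) (s (suc n)) (n !) {{_}} {{n ℕP.!≢0}}

  sumTo-index-weighted : ∀ f g n →
    sumTo (λ k → fromℕ k * (f k * g (suc n ∸ k))) (suc n) ≡ (D f ⊛ g) n
  sumTo-index-weighted f g n = begin
    sumTo (λ k → fromℕ k * (f k * g (suc n ∸ k))) (suc n)
      ≡⟨ sumTo-sucˡ (λ k → fromℕ k * (f k * g (suc n ∸ k))) n ⟩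
    0ℚ * (f 0 * g (suc n)) + rest
      ≡⟨ cong (_+ rest) (ℚP.*-zeroˡ (f 0 * g (suc n))) ⟩
    0ℚ + rest
      ≡⟨ ℚP.+-identityˡ rest ⟩
    rest
      ≡⟨ sumTo-cong n (λ i _ → sym (ℚP.*-assoc (fromℕ (suc i)) (f (suc i)) (g (n ∸ i)))) ⟩
    (D f ⊛ g) n
      ∎
    where
    rest : ℚ
    rest = sumTo (λ i → fromℕ (suc i) * (f (suc i) * g (n ∸ i))) n

  sumTo-coindex-weighted : ∀ f g n →
    sumTo (λ k → fromℕ (suc n ∸ k) * (f k * g (suc n ∸ k))) (suc n) ≡ (f ⊛ D g) n
  sumTo-coindex-weighted f g n = begin
    sumTo (λ k → fromℕ (suc n ∸ k) * (f k * g (suc n ∸ k))) (suc n)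
      ≡⟨ sumTo-reverse (λ k → fromℕ (suc n ∸ k) * (f k * g (suc n ∸ k))) (suc n) ⟩
    sumTo (λ k → fromℕ (suc n ∸ (suc n ∸ k)) * (f (suc n ∸ k) * g (suc n ∸ (suc n ∸ k)))) (suc n)
      ≡⟨ sumTo-cong (suc n) swap ⟩
    sumTo (λ k → fromℕ k * (g k * f (suc n ∸ k))) (suc n)
      ≡⟨ sumTo-index-weighted g f n ⟩
    (D g ⊛ f) n
      ≡⟨ ⊛-comm (D g) f n ⟩
    (f ⊛ D g) n
      ∎
    where
    swap : ∀ k → k ℕ.≤ suc n →
           fromℕ (suc n ∸ (suc n ∸ k)) * (f (suc n ∸ k) * g (suc n ∸ (suc n ∸ k)))
             ≡ fromℕ k * (g k * f (suc n ∸ k))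
    swap k k≤1+n rewrite ℕP.m∸[m∸n]≡n k≤1+n = cong (fromℕ k *_) (ℚP.*-comm (f (suc n ∸ k)) (g k))

  D-⊛ : ∀ f g → D (f ⊛ g) ≗ (D f ⊛ g) ⊕ (f ⊛ D g)
  D-⊛ f g n = begin
    fromℕ (suc n) * sumTo t (suc n)
      ≡⟨ sumTo-*ˡ (fromℕ (suc n)) t (suc n) ⟨
    sumTo (λ k → fromℕ (suc n) * t k) (suc n)
      ≡⟨ sumTo-cong (suc n) split ⟩
    sumTo (λ k → fromℕ k * t k + fromℕ (suc n ∸ k) * t k) (suc n)
      ≡⟨ sumTo-+ (λ k → fromℕ k * t k) (λ k → fromℕ (suc n ∸ k) * t k) (suc n) ⟩
    sumTo (λ k → fromℕ k * t k) (suc n) + sumTo (λ k → fromℕ (suc n ∸ k) * t k) (suc n)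
      ≡⟨ cong₂ _+_ (sumTo-index-weighted f g n) (sumTo-coindex-weighted f g n) ⟩
    (D f ⊛ g) n + (f ⊛ D g) n
      ∎
    where
    t : ℕ → ℚ
    t k = f k * g (suc n ∸ k)
    split : ∀ k → k ℕ.≤ suc n → fromℕ (suc n) * t k ≡ fromℕ k * t k + fromℕ (suc n ∸ k) * t k
    split k k≤1+n = begin
      fromℕ (suc n) * t k                    ≡⟨ cong (λ m → fromℕ m * t k) (ℕP.m+[n∸m]≡n k≤1+n) ⟨
      fromℕ (k ℕ.+ (suc n ∸ k)) * t k        ≡⟨ cong (_* t k) (fromℕ-+ k (suc n ∸ k)) ⟩
      (fromℕ k + fromℕ (suc n ∸ k)) * t k    ≡⟨ ℚP.*-distribʳ-+ (t k) (fromℕ k) (fromℕ (suc n ∸ k)) ⟩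
      fromℕ k * t k + fromℕ (suc n ∸ k) * t k ∎

D-unique : ∀ (Φ : ℕ → ℚ → ℚ) {f g} → f 0 ≡ g 0 →
           (∀ n → D f n ≡ Φ n (f n)) → (∀ n → D g n ≡ Φ n (g n)) → f ≗ g
D-unique Φ f₀≡g₀ Df Dg zero    = f₀≡g₀
D-unique Φ {f} {g} f₀≡g₀ Df Dg (suc n) = *-cancelʳ-fromℕ (suc n) (begin
  f (suc n) * fromℕ (suc n)  ≡⟨ ℚP.*-comm (f (suc n)) _ ⟩
  D f n                      ≡⟨ Df n ⟩
  Φ n (f n)                  ≡⟨ cong (Φ n) (D-unique Φ f₀≡g₀ Df Dg n) ⟩
  Φ n (g n)                  ≡⟨ Dg n ⟨
  D g n                      ≡⟨ ℚP.*-comm _ (g (suc n)) ⟩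
  g (suc n) * fromℕ (suc n)  ∎)
  where open ≡-Reasoning

D-expS : ∀ c → D (expS c) ≗ fromℕ c · expS c
D-expS c n = trans (D-egf (c ℕ.^_) n) (sym (fromℕ-*-/ c (c ℕ.^ n) (n !) {{n ℕP.!≢0}}))

expS-zero : expS 0 ≗ const 1ℚ
expS-zero zero    = refl
expS-zero (suc n) = ℚP.0/n≡0 (suc n !) {{suc n ℕP.!≢0}}

expS-suc : ∀ c → expS (suc c) ≗ expS 1 ⊛ expS c
expS-suc c = D-unique (λ _ x → fromℕ (suc c) * x) refl (D-expS (suc c)) D-product
  where
  open ≡-Reasoning
  product : PowerSeries
  product = expS 1 ⊛ expS c
  D-product : ∀ n → D product n ≡ fromℕ (suc c) * product n
  D-product n = begin
    D product n
      ≡⟨ D-⊛ (expS 1) (expS c) n ⟩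
    (D (expS 1) ⊛ expS c) n + (expS 1 ⊛ D (expS c)) n
      ≡⟨ cong₂ _+_ (⊛-congʳ (expS c) (D-expS 1) n) (⊛-congˡ (expS 1) (D-expS c) n) ⟩
    ((1ℚ · expS 1) ⊛ expS c) n + (expS 1 ⊛ (fromℕ c · expS c)) n
      ≡⟨ cong₂ _+_ (·-⊛ 1ℚ (expS 1) (expS c) n) (⊛-· (fromℕ c) (expS 1) (expS c) n) ⟩
    1ℚ * product n + fromℕ c * product n
      ≡⟨ ℚP.*-distribʳ-+ (product n) 1ℚ (fromℕ c) ⟨
    (1ℚ + fromℕ c) * product n
      ≡⟨ cong (_* product n) (fromℕ-+ 1 c) ⟨
    fromℕ (suc c) * product n
      ∎

expS≗expS1^ˢ : ∀ r → expS r ≗ expS 1 ^ˢ r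
expS≗expS1^ˢ zero    = expS-zero
expS≗expS1^ˢ (suc r) = λ n → trans (expS-suc r n) (⊛-congˡ (expS 1) (expS≗expS1^ˢ r) n)

sumL : ∀ {A : Set} → List A → (A → ℚ) → ℚ
sumL []       F = 0ℚ
sumL (x ∷ xs) F = F x + sumL xs F

module _ {A : Set} where
  sumL-++ : ∀ (xs ys : List A) F → sumL (xs ++ ys) F ≡ sumL xs F + sumL ys F
  sumL-++ []       ys F = sym (ℚP.+-identityˡ (sumL ys F))
  sumL-++ (x ∷ xs) ys F = trans (cong (_+_ (F x)) (sumL-++ xs ys F)) (sym (ℚP.+-assoc (F x) _ _))

  sumL-map : ∀ {B : Set} (h : B → A) xs F → sumL (List.map h xs) F ≡ sumL xs (λ x → F (h x))
  sumL-map h []       F = refl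
  sumL-map h (x ∷ xs) F = cong (_+_ (F (h x))) (sumL-map h xs F)

  sumL-concatMap : ∀ {B : Set} (h : B → List A) xs F → sumL (concatMap h xs) F ≡ sumL xs (λ x → sumL (h x) F)
  sumL-concatMap h []       F = refl
  sumL-concatMap h (x ∷ xs) F = trans (sumL-++ (h x) (concatMap h xs) F) (cong (_+_ (sumL (h x) F)) (sumL-concatMap h xs F))

  sumL-applyUpTo : ∀ (f : ℕ → A) n F → sumL (applyUpTo f (suc n)) F ≡ sumTo (λ i → F (f i)) n
  sumL-applyUpTo f zero    F = ℚP.+-identityʳ (F (f 0))
  sumL-applyUpTo f (suc n) F = trans (cong (_+_ (F (f 0))) (sumL-applyUpTo (λ i → f (suc i)) n F))
                                     (sym (sumTo-sucˡ (λ i → F (f i)) n))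

  sumL-*ˡ : ∀ a (xs : List A) F → sumL xs (λ x → a * F x) ≡ a * sumL xs F
  sumL-*ˡ a []       F = sym (ℚP.*-zeroʳ a)
  sumL-*ˡ a (x ∷ xs) F = trans (cong (_+_ (a * F x)) (sumL-*ˡ a xs F)) (sym (ℚP.*-distribˡ-+ a (F x) (sumL xs F)))

  sumL-cong : ∀ {P : A → Set} {xs F G} → All P xs → (∀ {x} → P x → F x ≡ G x) → sumL xs F ≡ sumL xs G
  sumL-cong []         F≡G = refl
  sumL-cong (px ∷ pxs) F≡G = cong₂ _+_ (F≡G px) (sumL-cong pxs F≡G)

  /-sum : ∀ (φ : A → ℕ) xs d .{{_ : ℕ.NonZero d}} → + sum (List.map φ xs) / d ≡ sumL xs (λ x → + φ x / d)
  /-sum φ []       d = ℚP.0/n≡0 d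
  /-sum φ (x ∷ xs) d = trans (sym (/-+ (φ x) (sum (List.map φ xs)) d)) (cong (_+_ (+ φ x / d)) (/-sum φ xs d))

S₂-vanish : ∀ {n k} → n < k → S₂ n k ≡ 0
S₂-vanish {zero}  {suc k} _           = refl
S₂-vanish {suc n} {suc k} (s≤s n<k)
  rewrite S₂-vanish (ℕP.m<n⇒m<1+n n<k) | S₂-vanish n<k = cong (ℕ._+ 0) (ℕP.*-zeroʳ (suc k))

ordPartitions : ℕ → PowerSeries
ordPartitions k = egf (λ n → k ! ℕ.* S₂ n k)

ordPartitions-vanish : ∀ k n → n < k → ordPartitions k n ≡ 0ℚ
ordPartitions-vanish k n n<k rewrite S₂-vanish n<k | ℕP.*-zeroʳ (k !) = ℚP.0/n≡0 (n !) {{n ℕP.!≢0}}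

ordPartitions-zero : ordPartitions 0 ≗ const 1ℚ
ordPartitions-zero zero    = refl
ordPartitions-zero (suc n) = ℚP.0/n≡0 (suc n !) {{suc n ℕP.!≢0}}

D-ordPartitions-zero : ∀ n → D (ordPartitions 0) n ≡ 0ℚ
D-ordPartitions-zero n = trans (cong (fromℕ (suc n) *_) (ordPartitions-zero (suc n))) (ℚP.*-zeroʳ (fromℕ (suc n)))

D-ordPartitions-suc : ∀ k → D (ordPartitions (suc k)) ≗ fromℕ (suc k) · (ordPartitions (suc k) ⊕ ordPartitions k)
D-ordPartitions-suc k n = begin
  D (ordPartitions (suc k)) n
    ≡⟨ D-egf (λ n → suc k ! ℕ.* S₂ n (suc k)) n ⟩
  + (suc k ! ℕ.* S₂ (suc n) (suc k)) / n !
    ≡⟨ cong (λ x → + x / n !) (stirling-recurrence (suc k) (k !) (S₂ n (suc k)) (S₂ n k)) ⟩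
  + (suc k ℕ.* (suc k ! ℕ.* S₂ n (suc k) ℕ.+ k ! ℕ.* S₂ n k)) / n !
    ≡⟨ fromℕ-*-/ (suc k) (suc k ! ℕ.* S₂ n (suc k) ℕ.+ k ! ℕ.* S₂ n k) (n !) ⟨
  fromℕ (suc k) * (+ (suc k ! ℕ.* S₂ n (suc k) ℕ.+ k ! ℕ.* S₂ n k) / n !)
    ≡⟨ cong (fromℕ (suc k) *_) (/-+ (suc k ! ℕ.* S₂ n (suc k)) (k ! ℕ.* S₂ n k) (n !)) ⟨
  fromℕ (suc k) * (ordPartitions (suc k) n + ordPartitions k n)
    ∎
  where
  open ≡-Reasoning
  instance
    n!-nonZero : ℕ.NonZero (n !)
    n!-nonZero = n ℕP.!≢0
  stirling-recurrence : ∀ a f s₁ s₀ → (a ℕ.* f) ℕ.* (a ℕ.* s₁ ℕ.+ s₀) ≡ a ℕ.* ((a ℕ.* f) ℕ.* s₁ ℕ.+ f ℕ.* s₀)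
  stirling-recurrence = ℕ-solve-∀

expm1 : PowerSeries
expm1 = expS 1 ⊕ (⊖ const 1ℚ)

D-expm1 : D expm1 ≗ expS 1
D-expm1 n = begin
  fromℕ (suc n) * (expS 1 (suc n) + 0ℚ)  ≡⟨ cong (fromℕ (suc n) *_) (ℚP.+-identityʳ (expS 1 (suc n))) ⟩
  D (expS 1) n                           ≡⟨ D-expS 1 n ⟩
  1ℚ * expS 1 n                          ≡⟨ ℚP.*-identityˡ (expS 1 n) ⟩
  expS 1 n                               ∎
  where open ≡-Reasoning

⊛-D-expm1 : ∀ f → f ⊛ D expm1 ≗ (f ⊛ expm1) ⊕ f
⊛-D-expm1 f = begin
  f ⊛ D expm1                     ≈⟨ ⊛-congˡ f (λ n → trans (D-expm1 n) (sym (minus-plus (expS 1 n) (const 1ℚ n)))) ⟩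
  f ⊛ (expm1 ⊕ const 1ℚ)          ≈⟨ ⊛-distribˡ-⊕ f expm1 (const 1ℚ) ⟩
  (f ⊛ expm1) ⊕ (f ⊛ const 1ℚ)    ≈⟨ (λ n → cong (_+_ ((f ⊛ expm1) n)) (⊛-identityʳ f n)) ⟩
  (f ⊛ expm1) ⊕ f                 ∎
  where
  open SeriesReasoning
  open +-*-Solver
  minus-plus : ∀ x y → x ℚ.- y + y ≡ x
  minus-plus = solve 2 (λ x y → x :- y :+ y := x) refl

-- Both sides solve y′ = (k+1)(y + U_k) with constant term 0; the case k+1 of the equation for
-- the right-hand side needs ordPartitions-suc k.
mutual
  ordPartitions-suc : ∀ k → ordPartitions (suc k) ≗ ordPartitions k ⊛ expm1
  ordPartitions-suc k = D-unique (λ n x → fromℕ (suc k) * (x + ordPartitions k n))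
    (trans (ordPartitions-vanish (suc k) 0 (s≤s z≤n)) (sym (ℚP.*-zeroʳ (ordPartitions k 0))))
    (D-ordPartitions-suc k) (D[ordPartitions⊛expm1] k)

  D[ordPartitions⊛expm1] : ∀ k n → D (ordPartitions k ⊛ expm1) n
                            ≡ fromℕ (suc k) * ((ordPartitions k ⊛ expm1) n + ordPartitions k n)
  D[ordPartitions⊛expm1] k n = begin
    D (ordPartitions k ⊛ expm1) n
      ≡⟨ D-⊛ (ordPartitions k) expm1 n ⟩
    (D (ordPartitions k) ⊛ expm1) n + (ordPartitions k ⊛ D expm1) n
      ≡⟨ cong₂ _+_ (D[ordPartitions]⊛expm1 k n) (⊛-D-expm1 (ordPartitions k) n) ⟩
    fromℕ k * y + y
      ≡⟨ cong (_+_ (fromℕ k * y)) (ℚP.*-identityˡ y) ⟨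
    fromℕ k * y + 1ℚ * y
      ≡⟨ ℚP.*-distribʳ-+ y (fromℕ k) 1ℚ ⟨
    (fromℕ k + 1ℚ) * y
      ≡⟨ cong (_* y) (trans (sym (fromℕ-+ k 1)) (cong fromℕ (ℕP.+-comm k 1))) ⟩
    fromℕ (suc k) * y
      ∎
    where
    open ≡-Reasoning
    y : ℚ
    y = (ordPartitions k ⊛ expm1) n + ordPartitions k n

  D[ordPartitions]⊛expm1 : ∀ k n → (D (ordPartitions k) ⊛ expm1) n
                             ≡ fromℕ k * ((ordPartitions k ⊛ expm1) n + ordPartitions k n)
  D[ordPartitions]⊛expm1 zero n = begin
    (D (ordPartitions 0) ⊛ expm1) n
      ≡⟨ sumTo-cong n (λ i _ → trans (cong (_* expm1 (n ∸ i)) (D-ordPartitions-zero i)) (ℚP.*-zeroˡ (expm1 (n ∸ i)))) ⟩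
    sumTo (λ _ → 0ℚ) n
      ≡⟨ sumTo-zero n ⟩
    0ℚ
      ≡⟨ ℚP.*-zeroˡ ((ordPartitions 0 ⊛ expm1) n + ordPartitions 0 n) ⟨
    0ℚ * ((ordPartitions 0 ⊛ expm1) n + ordPartitions 0 n)
      ∎
    where open ≡-Reasoning
  D[ordPartitions]⊛expm1 (suc k) n = begin
    (D (ordPartitions (suc k)) ⊛ expm1) n
      ≡⟨ ⊛-congʳ expm1 (D-ordPartitions-suc k) n ⟩
    ((fromℕ (suc k) · (ordPartitions (suc k) ⊕ ordPartitions k)) ⊛ expm1) n
      ≡⟨ ·-⊛ (fromℕ (suc k)) (ordPartitions (suc k) ⊕ ordPartitions k) expm1 n ⟩
    fromℕ (suc k) * ((ordPartitions (suc k) ⊕ ordPartitions k) ⊛ expm1) n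
      ≡⟨ cong (fromℕ (suc k) *_) (⊛-distribʳ-⊕ expm1 (ordPartitions (suc k)) (ordPartitions k) n) ⟩
    fromℕ (suc k) * ((ordPartitions (suc k) ⊛ expm1) n + (ordPartitions k ⊛ expm1) n)
      ≡⟨ cong (λ x → fromℕ (suc k) * ((ordPartitions (suc k) ⊛ expm1) n + x)) (ordPartitions-suc k n) ⟨
    fromℕ (suc k) * ((ordPartitions (suc k) ⊛ expm1) n + ordPartitions (suc k) n)
      ∎
    where open ≡-Reasoning

egf-a≡sum-ordPartitions : ∀ {n N} → n ℕ.≤ N → egf a n ≡ sumTo (λ k → ordPartitions k n) N
egf-a≡sum-ordPartitions {n} {N} n≤N = begin
  egf a n
    ≡⟨ /-sum (λ k → k ! ℕ.* S₂ n k) (List.upTo (suc n)) (n !) {{n ℕP.!≢0}} ⟩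
  sumL (List.upTo (suc n)) (λ k → ordPartitions k n)
    ≡⟨ sumL-applyUpTo (λ k → k) n (λ k → ordPartitions k n) ⟩
  sumTo (λ k → ordPartitions k n) n
    ≡⟨ sumTo-extend (λ k → ordPartitions k n) (λ k n<k → ordPartitions-vanish k n n<k) n≤N ⟨
  sumTo (λ k → ordPartitions k n) N
    ∎
  where open ≡-Reasoning

2-expS1≗1-expm1 : const (+ 2 / 1) ⊕ (⊖ expS 1) ≗ const 1ℚ ⊕ (⊖ expm1)
2-expS1≗1-expm1 zero    = refl
2-expS1≗1-expm1 (suc n) = cong (λ x → 0ℚ + - x) (sym (ℚP.+-identityʳ (expS 1 (suc n))))

ordPartitions-⊛-2-expS1 : ∀ k → ordPartitions k ⊛ (const (+ 2 / 1) ⊕ (⊖ expS 1))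
                               ≗ ordPartitions k ⊕ (⊖ ordPartitions (suc k))
ordPartitions-⊛-2-expS1 k = begin
  ordPartitions k ⊛ (const (+ 2 / 1) ⊕ (⊖ expS 1))
    ≈⟨ ⊛-congˡ (ordPartitions k) 2-expS1≗1-expm1 ⟩
  ordPartitions k ⊛ (const 1ℚ ⊕ (⊖ expm1))
    ≈⟨ ⊛-distribˡ-⊕ (ordPartitions k) (const 1ℚ) (⊖ expm1) ⟩
  (ordPartitions k ⊛ const 1ℚ) ⊕ (ordPartitions k ⊛ (⊖ expm1))
    ≈⟨ (λ n → cong₂ _+_ (⊛-identityʳ (ordPartitions k) n) (⊛-⊖ (ordPartitions k) expm1 n)) ⟩
  ordPartitions k ⊕ (⊖ (ordPartitions k ⊛ expm1))
    ≈⟨ (λ n → cong (λ x → ordPartitions k n + - x) (ordPartitions-suc k n)) ⟨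
  ordPartitions k ⊕ (⊖ ordPartitions (suc k))
    ∎
  where open SeriesReasoning

egf-a-⊛-2-expS1 : egf a ⊛ (const (+ 2 / 1) ⊕ (⊖ expS 1)) ≗ const 1ℚ
egf-a-⊛-2-expS1 n = begin
  sumTo (λ i → egf a i * G (n ∸ i)) n
    ≡⟨ sumTo-cong n (λ i i≤n → cong (_* G (n ∸ i)) (egf-a≡sum-ordPartitions i≤n)) ⟩
  sumTo (λ i → sumTo (λ k → ordPartitions k i) n * G (n ∸ i)) n
    ≡⟨ sumTo-cong n (λ i _ → sym (sumTo-*ʳ (G (n ∸ i)) (λ k → ordPartitions k i) n)) ⟩
  sumTo (λ i → sumTo (λ k → ordPartitions k i * G (n ∸ i)) n) n
    ≡⟨ sumTo-swap (λ i k → ordPartitions k i * G (n ∸ i)) n n ⟩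
  sumTo (λ k → (ordPartitions k ⊛ G) n) n
    ≡⟨ sumTo-cong n (λ k _ → ordPartitions-⊛-2-expS1 k n) ⟩
  sumTo (λ k → ordPartitions k n ℚ.- ordPartitions (suc k) n) n
    ≡⟨ sumTo-telescope (λ k → ordPartitions k n) n ⟩
  ordPartitions 0 n ℚ.- ordPartitions (suc n) n
    ≡⟨ cong₂ ℚ._-_ (ordPartitions-zero n) (ordPartitions-vanish (suc n) n ℕP.≤-refl) ⟩
  const 1ℚ n ℚ.- 0ℚ
    ≡⟨ ℚP.+-identityʳ (const 1ℚ n) ⟩
  const 1ℚ n
    ∎
  where
  open ≡-Reasoning
  G : PowerSeries
  G = const (+ 2 / 1) ⊕ (⊖ expS 1)

⊛-product : ∀ {k} → Vec PowerSeries k → PowerSeries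
⊛-product []       = const 1ℚ
⊛-product (f ∷ fs) = f ⊛ ⊛-product fs

coefficientProduct : ∀ {k} → Vec PowerSeries k → Vec ℕ k → ℚ
coefficientProduct []       []       = 1ℚ
coefficientProduct (f ∷ fs) (w ∷ ws) = f w * coefficientProduct fs ws

sum-compositions : ∀ {k} (fs : Vec PowerSeries k) n →
                   sumL (compositions k n) (coefficientProduct fs) ≡ ⊛-product fs n
sum-compositions []                 zero    = refl
sum-compositions []                 (suc n) = refl
sum-compositions {suc k} (f ∷ fs) n = begin
  sumL (concatMap (λ w → List.map (w ∷_) (compositions k (n ∸ w))) (List.upTo (suc n))) F
    ≡⟨ sumL-concatMap (λ w → List.map (w ∷_) (compositions k (n ∸ w))) (List.upTo (suc n)) F ⟩
  sumL (List.upTo (suc n)) (λ w → sumL (List.map (w ∷_) (compositions k (n ∸ w))) F)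
    ≡⟨ sumL-applyUpTo (λ w → w) n (λ w → sumL (List.map (w ∷_) (compositions k (n ∸ w))) F) ⟩
  sumTo (λ w → sumL (List.map (w ∷_) (compositions k (n ∸ w))) F) n
    ≡⟨ sumTo-cong n (λ w _ → sumL-map (w ∷_) (compositions k (n ∸ w)) F) ⟩
  sumTo (λ w → sumL (compositions k (n ∸ w)) (λ v → f w * coefficientProduct fs v)) n
    ≡⟨ sumTo-cong n (λ w _ → sumL-*ˡ (f w) (compositions k (n ∸ w)) (coefficientProduct fs)) ⟩
  sumTo (λ w → f w * sumL (compositions k (n ∸ w)) (coefficientProduct fs)) n
    ≡⟨ sumTo-cong n (λ w _ → cong (f w *_) (sum-compositions fs (n ∸ w))) ⟩
  (f ⊛ ⊛-product fs) n
    ∎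
  where
  open ≡-Reasoning
  F : Vec ℕ (suc k) → ℚ
  F = coefficientProduct (f ∷ fs)

⊛-product-replicate : ∀ j f → ⊛-product (Vec.replicate j f) ≗ f ^ˢ j
⊛-product-replicate zero    f = λ _ → refl
⊛-product-replicate (suc j) f = ⊛-congˡ f (⊛-product-replicate j f)

⊛-product-replicate-++ : ∀ r j f g → ⊛-product (Vec.replicate r f ++ᵛ Vec.replicate j g) ≗ (f ^ˢ r) ⊛ (g ^ˢ j)
⊛-product-replicate-++ zero    j f g n = trans (⊛-product-replicate j g n) (sym (⊛-identityˡ (g ^ˢ j) n))
⊛-product-replicate-++ (suc r) j f g n =
  trans (⊛-congˡ f (⊛-product-replicate-++ r j f g) n) (sym (⊛-assoc f (f ^ˢ r) (g ^ˢ j) n))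

factProd∣! : ∀ k n → All (λ v → factProd v ∣ n !) (compositions k n)
factProd∣! zero    zero    = ∣-refl ∷ []
factProd∣! zero    (suc n) = []
factProd∣! (suc k) n       = AllP.concat⁺ (AllP.map⁺ (AllP.applyUpTo⁺₁ (λ w → w) (suc n) extend))
  where
  extend : ∀ {w} → w < suc n → All (λ v → factProd v ∣ n !) (List.map (w ∷_) (compositions k (n ∸ w)))
  extend {w} (s≤s w≤n) = AllP.map⁺ (All.map (λ d → ∣-trans (*-monoʳ-∣ (w !) d) (k![n∸k]!∣n! w≤n)) (factProd∣! k (n ∸ w)))

[m/d*x]/m≡x/d : ∀ m d x .{{_ : ℕ.NonZero m}} .{{_ : ℕ.NonZero d}} → d ∣ m →
               + (m ℕ./ d ℕ.* x) / m ≡ + x / d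
[m/d*x]/m≡x/d m d x d∣m = sym (/-unique (m ℕ./ d ℕ.* x) m (begin
  (+ x / d) * fromℕ m                       ≡⟨ cong (λ m → (+ x / d) * fromℕ m) (ℕDM.m/n*n≡m d∣m) ⟨
  (+ x / d) * fromℕ (m ℕ./ d ℕ.* d)         ≡⟨ cong ((+ x / d) *_) (fromℕ-* (m ℕ./ d) d) ⟩
  (+ x / d) * (fromℕ (m ℕ./ d) * fromℕ d)   ≡⟨ *-x∙yz≈y∙xz (+ x / d) (fromℕ (m ℕ./ d)) (fromℕ d) ⟩
  fromℕ (m ℕ./ d) * ((+ x / d) * fromℕ d)   ≡⟨ cong (fromℕ (m ℕ./ d) *_) (/-*-fromℕ x d) ⟩
  fromℕ (m ℕ./ d) * fromℕ x                 ≡⟨ fromℕ-* (m ℕ./ d) x ⟨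
  fromℕ (m ℕ./ d ℕ.* x)                     ∎))
  where open ≡-Reasoning

/-factProd≡coefficientProduct : ∀ r j (v : Vec ℕ (r ℕ.+ j)) →
  ℚ._/_ (+ vprod (Vec.map a (drop r v))) (factProd v) {{factProd≢0 v}}
    ≡ coefficientProduct (Vec.replicate r (expS 1) ++ᵛ Vec.replicate j (egf a)) v
/-factProd≡coefficientProduct zero zero [] = refl
/-factProd≡coefficientProduct zero (suc j) (w ∷ v) =
  trans (sym (/-* (a w) (vprod (Vec.map a v)) (w !) (factProd v) {{w ℕP.!≢0}} {{factProd≢0 v}}))
        (cong (egf a w *_) (/-factProd≡coefficientProduct zero j v))
/-factProd≡coefficientProduct (suc r) j (w ∷ v) = begin
  ℚ._/_ (+ P) (w ! ℕ.* factProd v) {{factProd≢0 (w ∷ v)}}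
    ≡⟨ cong (λ x → ℚ._/_ (+ x) (w ! ℕ.* factProd v) {{factProd≢0 (w ∷ v)}}) (ℕP.*-identityˡ P) ⟨
  ℚ._/_ (+ (1 ℕ.* P)) (w ! ℕ.* factProd v) {{factProd≢0 (w ∷ v)}}
    ≡⟨ cong (λ x → ℚ._/_ (+ (x ℕ.* P)) (w ! ℕ.* factProd v) {{factProd≢0 (w ∷ v)}}) (ℕP.^-zeroˡ w) ⟨
  ℚ._/_ (+ (1 ℕ.^ w ℕ.* P)) (w ! ℕ.* factProd v) {{factProd≢0 (w ∷ v)}}
    ≡⟨ /-* (1 ℕ.^ w) P (w !) (factProd v) {{w ℕP.!≢0}} {{factProd≢0 v}} ⟨
  expS 1 w * ℚ._/_ (+ P) (factProd v) {{factProd≢0 v}}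
    ≡⟨ cong (expS 1 w *_) (/-factProd≡coefficientProduct r j v) ⟩
  expS 1 w * coefficientProduct (Vec.replicate r (expS 1) ++ᵛ Vec.replicate j (egf a)) v
    ∎
  where
  open ≡-Reasoning
  P : ℕ
  P = vprod (Vec.map a (drop r v))

egf-p : ∀ r j → egf (p r j) ≗ (expS 1 ^ˢ r) ⊛ (egf a ^ˢ j)
egf-p r j n = begin
  egf (p r j) n
    ≡⟨ /-sum term (compositions (r ℕ.+ j) n) (n !) {{n ℕP.!≢0}} ⟩
  sumL (compositions (r ℕ.+ j) n) (λ v → ℚ._/_ (+ term v) (n !) {{n ℕP.!≢0}})
    ≡⟨ sumL-cong (factProd∣! (r ℕ.+ j) n) (λ {v} v∣n! →
         trans ([m/d*x]/m≡x/d (n !) (factProd v) (vprod (Vec.map a (drop r v))) {{n ℕP.!≢0}} {{factProd≢0 v}} v∣n!)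
               (/-factProd≡coefficientProduct r j v)) ⟩
  sumL (compositions (r ℕ.+ j) n) (coefficientProduct fs)
    ≡⟨ sum-compositions fs n ⟩
  ⊛-product fs n
    ≡⟨ ⊛-product-replicate-++ r j (expS 1) (egf a) n ⟩
  ((expS 1 ^ˢ r) ⊛ (egf a ^ˢ j)) n
    ∎
  where
  open ≡-Reasoning
  term : Vec ℕ (r ℕ.+ j) → ℕ
  term v = multinomial n v ℕ.* vprod (Vec.map a (drop r v))
  fs : Vec PowerSeries (r ℕ.+ j)
  fs = Vec.replicate r (expS 1) ++ᵛ Vec.replicate j (egf a)

mainTheorem2 : (r j : ℕ) → 0 < r → 0 < j →
    ∀ n → egf (p r j) n ≡ (expS r ⊘ ((const (+ 2 / 1) ⊕ (⊖ expS 1)) ^ˢ j)) n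
-- The identity holds for all r and j.
mainTheorem2 r j _ _ n = trans (egf-p r j n) (⊘-unique (G ^ˢ j) Gʲ₀≢0 {q = (expS 1 ^ˢ r) ⊛ (egf a ^ˢ j)} quotient n)
  where
  open SeriesReasoning
  G : PowerSeries
  G = const (+ 2 / 1) ⊕ (⊖ expS 1)
  Gʲ₀≢0 : (G ^ˢ j) 0 ≢ 0ℚ
  Gʲ₀≢0 = subst (_≢ 0ℚ) (sym (^ˢ-constantTerm G j refl)) ℚP.1≢0
  quotient : ((expS 1 ^ˢ r) ⊛ (egf a ^ˢ j)) ⊛ (G ^ˢ j) ≗ expS r
  quotient = begin
    ((expS 1 ^ˢ r) ⊛ (egf a ^ˢ j)) ⊛ (G ^ˢ j)  ≈⟨ ⊛-assoc (expS 1 ^ˢ r) (egf a ^ˢ j) (G ^ˢ j) ⟩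
    (expS 1 ^ˢ r) ⊛ ((egf a ^ˢ j) ⊛ (G ^ˢ j))  ≈⟨ ⊛-congˡ (expS 1 ^ˢ r) (⊛-^ˢ (egf a) G j) ⟨
    (expS 1 ^ˢ r) ⊛ ((egf a ⊛ G) ^ˢ j)         ≈⟨ ⊛-congˡ (expS 1 ^ˢ r) (^ˢ-cong j egf-a-⊛-2-expS1) ⟩
    (expS 1 ^ˢ r) ⊛ (const 1ℚ ^ˢ j)            ≈⟨ ⊛-congˡ (expS 1 ^ˢ r) (1^ˢ j) ⟩
    (expS 1 ^ˢ r) ⊛ const 1ℚ                   ≈⟨ ⊛-identityʳ (expS 1 ^ˢ r) ⟩
    expS 1 ^ˢ r                                ≈⟨ expS≗expS1^ˢ r ⟨
    expS r                                     ∎
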